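{- Let $G=(A\cup B,E)$ be an instance of the strongly stable matching problem. If $S$ is a nonempty closed subset of $I(\mathcal{M}_G)$ and $M$ is a strongly stable matching with $[M]=\bigvee S$, then $S=C(U(M))$.
   Context: An instance of the strongly stable matching problem is a finite bipartite graph $G=(A\cup B,E)$ (vertices of $A$ are "men", of $B$ "women") in which every vertex $v$ has a preference list: its neighbours are partitioned into disjoint ties (possibly singletons) which are linearly ordered. For neighbours $x,y$ of $v$ write $x\succ_v y$ if $x$ lies in a strictly earlier tie than $y$, $x=_v y$ if in the same tie, $x\succeq_v y$ if either. A matching is a set of pairwise vertex-disjoint edges; $M(v)$ is the partner of $v$. An edge $e\in E\setminus M$ blocks $M$ if its endpoints can be labelled $x,y$ with ($x$ unmatched or $y\succ_x M(x)$) and ($y$ unmatched or $x\succeq_y M(y)$); $M$ is strongly stable if no edge blocks it. All strongly stable matchings match the same vertices. For strongly stable $M,N$: $M\succeq N$ ($M$ dominates $N$) if $M(m)\succeq_m N(m)$ for every matched man $m$; $M\sim N$ if $M(m)=_m N(m)$ for every matched man $m$; $[M]$ is the $\sim$-class of $M$, and $[M]\succeq[N]$ iff $M\succeq N$. The operation $M\vee N$ is the matching containing, for each matched man $m$, the edge $(m,N(m))$ if $M(m)\succ_m N(m)$ and $(m,M(m))$ otherwise; it is strongly stable, and $[M]\vee[N]:=[M\vee N]$ is well defined. For a nonempty finite set $S$ of classes, $\bigvee S$ is the iterated $\vee$ of its elements. For an edge $(a,b)$ ($a\in A$) contained in some strongly stable matching, let $N$ be a strongly stable matching containing $(a,b)$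 that dominates every strongly stable matching containing $(a,b)$ (such $N$ exists); define $M(a,b):=[N]$. A class is irreducible if it equals $M(a,b)$ for some such edge; $I(\mathcal{M}_G)$ is the set of irreducible classes, partially ordered by dominance. A subset $S\subseteq I(\mathcal{M}_G)$ is closed if whenever $T\in S$ and $T'\in I(\mathcal{M}_G)$ dominates $T$, then $T'\in S$. For a strongly stable matching $M$, $U(M)=\{M(a,b):(a,b)\in M\}$ and $C(U(M))$ is the set of irreducible classes dominating some element of $U(M)$. -}

module Defs where

open import Data.Nat using (ℕ; _≤_; _<_; _<ᵇ_)
open import Data.Fin using (Fin)
open import Data.Bool using (Bool; T; if_then_else_)
open import Data.Maybe using (Maybe; just; nothing)
open import Data.Product using (Σ; ∃; ∃-syntax; _×_; _,_)
open import Data.Sum using (_⊎_)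
open import Data.List using (List; foldl)
open import Data.List.Relation.Unary.Any using (Any)
open import Relation.Binary.PropositionalEquality using (_≡_; _≢_)
open import Relation.Nullary using (¬_)

-- Preference lists with ties are encoded by ranks:
-- for a neighbour x of v, rank = index of the tie containing x (smaller =
-- strictly better, equal = same tie).  Ranks of non-neighbours are irrelevant.
record Instance : Set where
  field
    m n   : ℕ
    adj   : Fin m → Fin n → Bool
    rankA : Fin m → Fin n → ℕ
    rankB : Fin n → Fin m → ℕ

module _ (G : Instance) where
  open Instance G

  Edge : Fin m → Fin n → Set
  Edge a b = T (adj a b)

  Matching : Set
  Matching = Fin m → Maybe (Fin n)

  IsMatching : Matching → Set
  IsMatching M =
    (∀ a b → M a ≡ just b → Edge a b) ×
    (∀ a a' b → M a ≡ just b → M a' ≡ just b → a ≡ a')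

  PrefA : Matching → Fin m → Fin n → Set
  PrefA M a b = M a ≡ nothing ⊎ ∃[ b' ] (M a ≡ just b' × rankA a b < rankA a b')

  WPrefA : Matching → Fin m → Fin n → Set
  WPrefA M a b = M a ≡ nothing ⊎ ∃[ b' ] (M a ≡ just b' × rankA a b ≤ rankA a b')

  PrefB : Matching → Fin n → Fin m → Set
  PrefB M b a = (∀ a' → M a' ≢ just b) ⊎ ∃[ a' ] (M a' ≡ just b × rankB b a < rankB b a')

  WPrefB : Matching → Fin n → Fin m → Set
  WPrefB M b a = (∀ a' → M a' ≢ just b) ⊎ ∃[ a' ] (M a' ≡ just b × rankB b a ≤ rankB b a')

  Blocks : Matching → Fin m → Fin n → Set
  Blocks M a b = Edge a b × M a ≢ just b ×
    ((PrefA M a b × WPrefB M b a) ⊎ (PrefB M b a × WPrefA M a b))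

  StronglyStable : Matching → Set
  StronglyStable M = IsMatching M × (∀ a b → ¬ Blocks M a b)

  -- M ⪰ N : every matched man weakly prefers M(m) to N(m)
  -- (strongly stable matchings all match the same men)
  _⪰_ : Matching → Matching → Set
  M ⪰ N = ∀ a b b' → M a ≡ just b → N a ≡ just b' → rankA a b ≤ rankA a b'

  _∼_ : Matching → Matching → Set
  M ∼ N = ∀ a b b' → M a ≡ just b → N a ≡ just b' → rankA a b ≡ rankA a b'

  _∨_ : Matching → Matching → Matching
  (M ∨ N) a with M a | N a
  ... | just b | just b' = if rankA a b <ᵇ rankA a b' then just b' else just b
  ... | x      | _       = x

  ⋁ : Matching → List Matching → Matching
  ⋁ s ss = foldl _∨_ s ss

  -- N is a strongly stable matching containing (a,b) dominating every
  -- strongly stable matching containing (a,b); its class is M(a,b)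
  IsMab : Fin m → Fin n → Matching → Set
  IsMab a b N = StronglyStable N × N a ≡ just b ×
    (∀ N' → StronglyStable N' → N' a ≡ just b → N ⪰ N')

  Irreducible : Matching → Set
  Irreducible T = StronglyStable T × ∃[ a ] ∃[ b ] ∃[ N ] (IsMab a b N × T ∼ N)

  _∈ₛ_ : Matching → List Matching → Set
  T ∈ₛ S = Any (λ N → T ∼ N) S

  Closed : List Matching → Set
  Closed S = ∀ N T' → Any (N ≡_) S → Irreducible T' → T' ⪰ N → T' ∈ₛ S

  -- [T] ∈ C(U(M)) : [T] irreducible and dominates M(a,b) for some (a,b) ∈ M
  InCU : Matching → Matching → Set
  InCU M T = Irreducible T ×
    ∃[ a ] ∃[ b ] ∃[ N ] (M a ≡ just b × IsMab a b N × T ⪰ N)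

module Submission where

-- Write J = ⋁ S.  Both inclusions of S = C(U(M)) rest on one maximality
-- fact (mab-dominates): if N represents M(a,b) and P is strongly stable with
-- a's partner in P no better than b, then N ⪰ P, because the men-optimal
-- combination N ⊔ P is strongly stable and still contains (a,b).
--   S ⊆ C(U(M)): for [T] = [P] = M(c,d) with P ∈ S, the partner of c in J is
--     his worst partner over S, so his partner b in M ∼ J is no better than
--     d; hence M(c,d) ⪰ M(c,b), and (c,b) ∈ M witnesses [T] ∈ C(U(M)).
--   C(U(M)) ⊆ S: for (a,b) ∈ M with [T] ⪰ M(a,b), the partner of a in J is
--     his partner in some P ∈ S and is tied with b; so M(a,b) ⪰ P, T ⪰ P and
--     closedness of S gives [T] ∈ S.

open import Defs
open import Data.List using (List; _∷_; []; foldl; map; concat; allFin)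
open import Data.List.Relation.Unary.All as All using (All; []; _∷_; lookup; lookupAny)
open import Data.List.Relation.Unary.Any as Any using (Any; here; there)
open import Data.List.Relation.Unary.Any.Properties using (map⁺; concat⁺)
open import Data.List.Membership.Propositional using (_∈_; find)
open import Data.List.Membership.Propositional.Properties using (∈-map⁺; ∈-allFin)
open import Data.Product as Prod using (_×_; _,_; proj₁; proj₂; Σ; ∃-syntax)
open import Data.Sum as Sum using (_⊎_; inj₁; inj₂)
open import Data.Nat using (ℕ; zero; suc; _≤_; _<_; _<ᵇ_; _<?_; _≤?_)
open import Data.Nat.Properties
  using (≤-refl; ≤-trans; ≤-reflexive; <⇒≤; <-irrefl; <-trans; <-≤-trans;
         ≰⇒>; ≮⇒≥; <⇒≱; 1+n≰n; <ᵇ⇒<; <⇒<ᵇ)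
open import Data.Fin using (Fin; zero; suc; punchOut)
open import Data.Fin.Properties using (any?; all?; punchOut-injective; injective⇒≤)
  renaming (_≟_ to _≟ᶠ_)
open import Data.Maybe using (Maybe; just; nothing)
open import Data.Maybe.Properties using (just-injective; ≡-dec)
open import Data.Bool using (true; false; T; T?; if_then_else_)
open import Data.Unit using (tt)
open import Data.Vec.Functional using (Vector) renaming (_∷_ to _∷ᵛ_; [] to []ᵛ)
open import Data.Empty using (⊥; ⊥-elim)
open import Function using (_∘_)
open import Function.Definitions using (Injective)
open import Relation.Binary.PropositionalEquality
open import Relation.Nullary
  using (¬_; Dec; yes; no; contradiction; ¬?; _×-dec_; _⊎-dec_; _→-dec_)

-- An injective endomap of a finite set is onto: a map missing a point
-- would inject Fin (suc k) into Fin k.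
injective⇒onto : ∀ {k} (f : Fin k → Fin k) → Injective _≡_ _≡_ f →
                 ∀ y → ∃[ x ] f x ≡ y
injective⇒onto f f-inj y with any? (λ x → f x ≟ᶠ y)
... | yes hit = hit
injective⇒onto {suc k} f f-inj y | no miss =
  contradiction (injective⇒≤ {f = f′} f′-inj) 1+n≰n
  where
  f′ : Fin (suc k) → Fin k
  f′ x = punchOut {i = y} {j = f x} (λ y≡fx → miss (x , sym y≡fx))
  f′-inj : Injective _≡_ _≡_ f′
  f′-inj {x} {x′} eq = f-inj (punchOut-injective {i = y} _ _ eq)

-- Relative form: an injective map from a decidable subset P of a finite set
-- into P is onto P.  (Extend it by the identity off P and apply the above.)
module _ {k} (P : Fin k → Set) (P? : ∀ x → Dec (P x))
         (f : ∀ x → P x → Fin k) (f-into : ∀ x p → P (f x p))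
         (f-inj : ∀ x x′ p p′ → f x p ≡ f x′ p′ → x ≡ x′) where

  private
    g : Fin k → Fin k
    g x with P? x
    ... | yes p = f x p
    ... | no _  = x

    g-inj : Injective _≡_ _≡_ g
    g-inj {x} {x′} eq with P? x | P? x′
    ... | yes p  | yes p′ = f-inj x x′ p p′ eq
    ... | yes p  | no ¬p′ = ⊥-elim (¬p′ (subst P eq (f-into x p)))
    ... | no ¬p  | yes p′ = ⊥-elim (¬p (subst P (sym eq) (f-into x′ p′)))
    ... | no _   | no _   = eq

    g-back : ∀ x y → g x ≡ y → P y → Σ (P x) λ p → f x p ≡ y
    g-back x y gx≡y py with P? x
    ... | yes p = p , gx≡y
    ... | no ¬p = ⊥-elim (¬p (subst P (sym gx≡y) py))

  injective⇒onto-subset : ∀ y → P y → ∃[ x ] Σ (P x) λ p → f x p ≡ y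
  injective⇒onto-subset y py with injective⇒onto g g-inj y
  ... | x , gx≡y = x , g-back x y gx≡y py

if-<ᵇ : ∀ {A : Set} (i j : ℕ) (x y : A) →
        (i < j × (if i <ᵇ j then x else y) ≡ x) ⊎
        (j ≤ i × (if i <ᵇ j then x else y) ≡ y)
if-<ᵇ i j x y with i <ᵇ j in eq
... | true  = inj₁ (<ᵇ⇒< i j (subst T (sym eq) tt) , refl)
... | false = inj₂ (≮⇒≥ (λ i<j → subst T eq (<⇒<ᵇ i<j)) , refl)

if-just≢nothing : ∀ {A : Set} c {x y : A} → (if c then just x else just y) ≢ nothing
if-just≢nothing true  ()
if-just≢nothing false ()

functions : ∀ {A : Set} → List A → (k : ℕ) → List (Vector A k)
functions vs zero    = []ᵛ ∷ []
functions vs (suc k) = concat (map (λ v → map (v ∷ᵛ_) (functions vs k)) vs)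

functions-complete : ∀ {A : Set} {vs : List A} → (∀ v → v ∈ vs) →
                     ∀ k (f : Vector A k) → Any (_≗ f) (functions vs k)
functions-complete every zero f = here (λ ())
functions-complete {vs = vs} every (suc k) f =
  concat⁺ (map⁺ (Any.map extend (every (f zero))))
  where
  extend : ∀ {v} → f zero ≡ v → Any (_≗ f) (map (v ∷ᵛ_) (functions vs k))
  extend refl = map⁺ (Any.map (λ g≗ → λ { zero → refl ; (suc i) → g≗ i })
                              (functions-complete every k (f ∘ suc)))

module Theory (G : Instance) where
  open Instance G

  SS : Matching G → Set
  SS = StronglyStable G

  _⪰′_ _∼′_ : Matching G → Matching G → Set
  X ⪰′ Y = _⪰_ G X Y
  X ∼′ Y = _∼_ G X Y

  _∨′_ : Matching G → Matching G → Matching G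
  X ∨′ Y = _∨_ G X Y

  just-unique : ∀ {A : Set} {u : Maybe A} {x y} → u ≡ just x → u ≡ just y → x ≡ y
  just-unique p q = just-injective (trans (sym p) q)

  ≡nothing⇒≢just : ∀ {A : Set} {u : Maybe A} {x} → u ≡ nothing → u ≢ just x
  ≡nothing⇒≢just refl ()

  module _ {X : Matching G} (ssX : SS X) where
    edge-of : ∀ {a w} → X a ≡ just w → Edge G a w
    edge-of {a} {w} = proj₁ (proj₁ ssX) a w

    partner-injective : ∀ {a a′ w} → X a ≡ just w → X a′ ≡ just w → a ≡ a′
    partner-injective {a} {a′} {w} = proj₂ (proj₁ ssX) a a′ w

    not-blocking : ∀ a w → ¬ Blocks G X a w
    not-blocking = proj₂ ssX

  prefA⇒< : ∀ {X a w b} → PrefA G X a w → X a ≡ just b → rankA a w < rankA a b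
  prefA⇒< (inj₁ xn) xa = ⊥-elim (≡nothing⇒≢just xn xa)
  prefA⇒< (inj₂ (b′ , xa′ , lt)) xa rewrite just-unique xa xa′ = lt

  prefA⇒≢ : ∀ {X a w} → PrefA G X a w → X a ≢ just w
  prefA⇒≢ {X} pref xa = <-irrefl refl (prefA⇒< {X} pref xa)

  Prefers : Matching G → Matching G → Fin m → Set
  Prefers X Y a = ∃[ w ] (X a ≡ just w × PrefA G Y a w)

  _≟ₘ_ : (u v : Maybe (Fin n)) → Dec (u ≡ v)
  _≟ₘ_ = ≡-dec _≟ᶠ_

  matched? : ∀ (X : Matching G) w → Dec (∃[ a ] X a ≡ just w)
  matched? X w = any? (λ a → X a ≟ₘ just w)

  prefA? : ∀ (X : Matching G) a w → Dec (PrefA G X a w)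
  prefA? X a w = (X a ≟ₘ nothing) ⊎-dec
    any? (λ b → (X a ≟ₘ just b) ×-dec (rankA a w <? rankA a b))

  wprefA? : ∀ (X : Matching G) a w → Dec (WPrefA G X a w)
  wprefA? X a w = (X a ≟ₘ nothing) ⊎-dec
    any? (λ b → (X a ≟ₘ just b) ×-dec (rankA a w ≤? rankA a b))

  prefB? : ∀ (X : Matching G) w a → Dec (PrefB G X w a)
  prefB? X w a = all? (λ a′ → ¬? (X a′ ≟ₘ just w)) ⊎-dec
    any? (λ a′ → (X a′ ≟ₘ just w) ×-dec (rankB w a <? rankB w a′))

  wprefB? : ∀ (X : Matching G) w a → Dec (WPrefB G X w a)
  wprefB? X w a = all? (λ a′ → ¬? (X a′ ≟ₘ just w)) ⊎-dec
    any? (λ a′ → (X a′ ≟ₘ just w) ×-dec (rankB w a ≤? rankB w a′))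

  prefers? : ∀ (X Y : Matching G) a → Dec (Prefers X Y a)
  prefers? X Y a = any? (λ w → (X a ≟ₘ just w) ×-dec prefA? Y a w)

  SS? : ∀ (X : Matching G) → Dec (SS X)
  SS? X = is-matching? ×-dec all? (λ a → all? (λ w → ¬? (blocks? a w)))
    where
    is-matching? : Dec (IsMatching G X)
    is-matching? =
      all? (λ a → all? (λ w → (X a ≟ₘ just w) →-dec T? (adj a w))) ×-dec
      all? (λ a → all? (λ a′ → all? (λ w →
        (X a ≟ₘ just w) →-dec ((X a′ ≟ₘ just w) →-dec (a ≟ᶠ a′)))))
    blocks? : ∀ a w → Dec (Blocks G X a w)
    blocks? a w = T? (adj a w) ×-dec ¬? (X a ≟ₘ just w) ×-dec
      ((prefA? X a w ×-dec wprefB? X w a) ⊎-dec (prefB? X w a ×-dec wprefA? X a w))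

  SS-resp-≗ : ∀ {X Y} → X ≗ Y → SS Y → SS X
  SS-resp-≗ {X} {Y} X≗Y ((edge , inj) , stable) =
    ((λ a w → edge a w ∘ to) , (λ a a′ w p q → inj a a′ w (to p) (to q))) ,
    λ { a w (e , ne , inj₁ (p , q)) →
          stable a w (e , ne ∘ from , inj₁ (onA p , onB q))
      ; a w (e , ne , inj₂ (p , q)) →
          stable a w (e , ne ∘ from , inj₂ (onB p , onA q)) }
    where
    to : ∀ {a u} → X a ≡ u → Y a ≡ u
    to {a} = trans (sym (X≗Y a))
    from : ∀ {a u} → Y a ≡ u → X a ≡ u
    from {a} = trans (X≗Y a)
    onA : ∀ {a} {R : Fin n → Set} →
          X a ≡ nothing ⊎ ∃[ b ] (X a ≡ just b × R b) →
          Y a ≡ nothing ⊎ ∃[ b ] (Y a ≡ just b × R b)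
    onA = Sum.map to (Prod.map₂ (Prod.map₁ to))
    onB : ∀ {w} {R : Fin m → Set} →
          (∀ a → X a ≢ just w) ⊎ ∃[ a ] (X a ≡ just w × R a) →
          (∀ a → Y a ≢ just w) ⊎ ∃[ a ] (Y a ≡ just w × R a)
    onB = Sum.map (λ h a → h a ∘ from) (Prod.map₂ (Prod.map₁ to))

  -- If a is X-matched to w but strictly prefers w to his Y-partner, then,
  -- Y being strongly stable, w has a Y-partner a′ she strictly prefers to a;
  -- and X being strongly stable, a′ strictly prefers his X-partner to w.
  rival : ∀ {X Y} → SS X → SS Y → ∀ {a w} → X a ≡ just w → PrefA G Y a w →
          ∃[ a′ ] (Y a′ ≡ just w × Prefers X Y a′)
  rival {X} {Y} ssX ssY {a} {w} xa pref with matched? Y w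
  ... | no w-free = ⊥-elim (not-blocking ssY a w
        (edge-of ssX xa , prefA⇒≢ {Y} pref , inj₁ (pref , inj₁ λ a′ ya′ → w-free (a′ , ya′))))
  ... | yes (a′ , ya′) with rankB w a ≤? rankB w a′
  ...   | yes a≽a′ = ⊥-elim (not-blocking ssY a w
          (edge-of ssX xa , prefA⇒≢ {Y} pref , inj₁ (pref , inj₂ (a′ , ya′ , a≽a′))))
  ...   | no a≺a′ = a′ , ya′ , a′-prefers-X
    where
    a′≻a : rankB w a′ < rankB w a
    a′≻a = ≰⇒> a≺a′

    x≢w : X a′ ≢ just w
    x≢w xa′ with partner-injective ssX xa′ xa
    ... | refl = prefA⇒≢ {Y} pref ya′

    a′-prefers-X : Prefers X Y a′
    a′-prefers-X with X a′ in xa′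
    ... | nothing = ⊥-elim (not-blocking ssX a′ w
          (edge-of ssY ya′ , x≢w , inj₂ (inj₂ (a , xa , a′≻a) , inj₁ xa′)))
    ... | just w′ with rankA a′ w ≤? rankA a′ w′
    ...   | yes w≽w′ = ⊥-elim (not-blocking ssX a′ w
            (edge-of ssY ya′ , x≢w , inj₂ (inj₂ (a , xa , a′≻a) , inj₂ (w′ , xa′ , w≽w′))))
    ...   | no w≺w′ = w′ , refl , inj₂ (w , ya′ , ≰⇒> w≺w′)

  -- Distinct men preferring X have distinct rivals (their rivals are
  -- Y-matched to their distinct X-partners), so by finiteness the rival map
  -- is onto the men preferring X to Y: the Y-partner of each such man is the
  -- X-partner of another such man.
  prefers-onto : ∀ {X Y} → SS X → SS Y → ∀ a → Prefers X Y a →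
                 ∃[ a′ ] ∃[ w ] (X a′ ≡ just w × PrefA G Y a′ w × Y a ≡ just w)
  prefers-onto {X} {Y} ssX ssY a a-prefers
    with injective⇒onto-subset (Prefers X Y) (prefers? X Y) r r-into r-inj a a-prefers
    where
    r : ∀ x → Prefers X Y x → Fin m
    r x (w , xw , pref) = proj₁ (rival ssX ssY xw pref)
    r-into : ∀ x p → Prefers X Y (r x p)
    r-into x (w , xw , pref) = proj₂ (proj₂ (rival ssX ssY xw pref))
    r-inj : ∀ x x′ p p′ → r x p ≡ r x′ p′ → x ≡ x′
    r-inj x x′ (w , xw , pref) (w′ , xw′ , pref′) eq
      with rival ssX ssY xw pref | rival ssX ssY xw′ pref′
    ... | a₁ , ya₁ , _ | a₂ , ya₂ , _ with eq
    ... | refl with just-unique ya₁ ya₂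
    ... | refl = partner-injective ssX xw xw′
  ... | a′ , (w , xa′ , pref) , refl =
    a′ , w , xa′ , pref , proj₁ (proj₂ (rival ssX ssY xa′ pref))

  -- Strongly stable matchings match the same men: a man matched in X but not
  -- in Y prefers X, so he would be the Y-partner of someone.
  same-men : ∀ {X Y} → SS X → SS Y → ∀ {a w} → X a ≡ just w → ∃[ w′ ] Y a ≡ just w′
  same-men {X} {Y} ssX ssY {a} {w} xa with Y a in ya
  ... | just w′ = w′ , refl
  ... | nothing with prefers-onto ssX ssY a (w , xa , inj₁ ya)
  ...   | _ , _ , _ , _ , ya′ = ⊥-elim (≡nothing⇒≢just ya ya′)

  -- dominance is transitive, and tie-equivalence is transitive and implies
  -- dominance (transitivity needs the middle matching to match the same men)
  ⪰-trans : ∀ {X Y Z} → SS X → SS Y → X ⪰′ Y → Y ⪰′ Z → X ⪰′ Z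
  ⪰-trans ssX ssY X⪰Y Y⪰Z a b b″ xa za with same-men ssX ssY xa
  ... | b′ , ya = ≤-trans (X⪰Y a b b′ xa ya) (Y⪰Z a b′ b″ ya za)

  ∼-trans : ∀ {X Y Z} → SS X → SS Y → X ∼′ Y → Y ∼′ Z → X ∼′ Z
  ∼-trans ssX ssY X∼Y Y∼Z a b b″ xa za with same-men ssX ssY xa
  ... | b′ , ya = trans (X∼Y a b b′ xa ya) (Y∼Z a b′ b″ ya za)

  ∼⇒⪰ : ∀ {X Y} → X ∼′ Y → X ⪰′ Y
  ∼⇒⪰ X∼Y a b b′ xa ya = ≤-reflexive (X∼Y a b b′ xa ya)

  -- The men-optimal combination: each man keeps the better of his two
  -- partners (preferring X on ties).  It dominates both arguments, unlike ∨,
  -- which gives each man the worse one.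
  better : Fin m → Maybe (Fin n) → Maybe (Fin n) → Maybe (Fin n)
  better a (just b) (just b′) = if rankA a b′ <ᵇ rankA a b then just b′ else just b
  better a u        _         = u

  _⊔_ : Matching G → Matching G → Matching G
  (X ⊔ Y) a = better a (X a) (Y a)

  ⊔-both : ∀ {X Y a b b′} → X a ≡ just b → Y a ≡ just b′ →
           (X ⊔ Y) a ≡ (if rankA a b′ <ᵇ rankA a b then just b′ else just b)
  ⊔-both xa ya rewrite xa | ya = refl

  ⊔-keeps : ∀ {X Y a b b′} → X a ≡ just b → Y a ≡ just b′ →
            rankA a b ≤ rankA a b′ → (X ⊔ Y) a ≡ just b
  ⊔-keeps {X} {Y} {a} {b} {b′} xa ya b≽b′ with if-<ᵇ (rankA a b′) (rankA a b) (just b′) (just b)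
  ... | inj₁ (b′≻b , _) = ⊥-elim (<⇒≱ b′≻b b≽b′)
  ... | inj₂ (_ , e)    = trans (⊔-both {X} {Y} xa ya) e

  module Join {X Y : Matching G} (ssX : SS X) (ssY : SS Y) where

    W : Matching G
    W = X ⊔ Y

    data Source (a : Fin m) (w : Fin n) : Set where
      from-X : ∀ {b′} → X a ≡ just w → Y a ≡ just b′ → rankA a w ≤ rankA a b′ → Source a w
      from-Y : ∀ {b}  → X a ≡ just b → Y a ≡ just w → rankA a w < rankA a b → Source a w

    source : ∀ {a w} → W a ≡ just w → Source a w
    source {a} {w} wa with X a in xa | Y a in ya | wa
    ... | nothing | _       | ()
    ... | just _  | nothing | _ = ⊥-elim (≡nothing⇒≢just ya (proj₂ (same-men ssX ssY xa)))
    ... | just b  | just b′ | wa′ with if-<ᵇ (rankA a b′) (rankA a b) (just b′) (just b)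
    ...   | inj₁ (b′≻b , e) with just-injective (trans (sym e) wa′)
    ...     | refl = from-Y xa ya b′≻b
    source {a} {w} wa | just b | just b′ | wa′ | inj₂ (b≽b′ , e)
      with just-injective (trans (sym e) wa′)
    ...     | refl = from-X xa ya b≽b′

    unmatched-both : ∀ {a} → W a ≡ nothing → X a ≡ nothing × Y a ≡ nothing
    unmatched-both {a} wa with X a in xa | Y a in ya | wa
    ... | nothing | nothing | _ = refl , refl
    ... | nothing | just _  | _ = ⊥-elim (≡nothing⇒≢just xa (proj₂ (same-men ssY ssX ya)))
    ... | just _  | nothing | _ = ⊥-elim (≡nothing⇒≢just ya (proj₂ (same-men ssX ssY xa)))
    ... | just _  | just _  | wa′ = ⊥-elim (if-just≢nothing _ wa′)

    ⊔-dominates-X : W ⪰′ X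
    ⊔-dominates-X a w b wa xa with source wa
    ... | from-X xa′ _ _ rewrite just-unique xa xa′ = ≤-refl
    ... | from-Y xa′ _ w≻b rewrite just-unique xa xa′ = <⇒≤ w≻b

    ⊔-dominates-Y : W ⪰′ Y
    ⊔-dominates-Y a w b′ wa ya with source wa
    ... | from-X _ ya′ w≽b′ rewrite just-unique ya ya′ = w≽b′
    ... | from-Y _ ya′ _ rewrite just-unique ya ya′ = ≤-refl

    ⊔-takes-Y : ∀ {a w} → Y a ≡ just w → PrefA G X a w → W a ≡ just w
    ⊔-takes-Y {a} {w} ya pref with same-men ssY ssX ya
    ... | b , xa with if-<ᵇ (rankA a w) (rankA a b) (just w) (just b)
    ...   | inj₁ (_ , e)   = trans (⊔-both {X} {Y} xa ya) e
    ...   | inj₂ (b≽w , _) = ⊥-elim (<⇒≱ (prefA⇒< {X} pref xa) b≽w)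

    ⊔-pref : ∀ {a w} → PrefA G W a w → PrefA G X a w × PrefA G Y a w
    ⊔-pref (inj₁ wa) = Prod.map inj₁ inj₁ (unmatched-both wa)
    ⊔-pref (inj₂ (z , wa , w≻z)) with source wa
    ... | from-X xa ya z≽b′ = inj₂ (z , xa , w≻z) , inj₂ (_ , ya , <-≤-trans w≻z z≽b′)
    ... | from-Y xa ya z≻b  = inj₂ (_ , xa , <-trans w≻z z≻b) , inj₂ (z , ya , w≻z)

    ⊔-wpref : ∀ {a w} → WPrefA G W a w → WPrefA G X a w × WPrefA G Y a w
    ⊔-wpref (inj₁ wa) = Prod.map inj₁ inj₁ (unmatched-both wa)
    ⊔-wpref (inj₂ (z , wa , w≽z)) with source wa
    ... | from-X xa ya z≽b′ = inj₂ (z , xa , w≽z) , inj₂ (_ , ya , ≤-trans w≽z z≽b′)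
    ... | from-Y xa ya z≻b  = inj₂ (_ , xa , ≤-trans w≽z (<⇒≤ z≻b)) , inj₂ (z , ya , w≽z)

    -- every woman matched in X is matched in W: if her X-partner took his
    -- Y-partner instead, the surjectivity of rivals provides a man who
    -- strictly prefers her as his Y-partner and so takes her in W
    ⊔-covers-X : ∀ {a w} → X a ≡ just w → ∃[ a′ ] W a′ ≡ just w
    ⊔-covers-X {a} {w} xa with same-men ssX ssY xa
    ... | b′ , ya with rankA a w ≤? rankA a b′
    ...   | yes w≽b′ = a , ⊔-keeps {X} {Y} xa ya w≽b′
    ...   | no w≺b′ with prefers-onto ssY ssX a (b′ , ya , inj₂ (w , xa , ≰⇒> w≺b′))
    ...     | a′ , u , ya′ , pref , xa″ rewrite just-unique xa xa″ = a′ , ⊔-takes-Y ya′ pref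

    -- Two men cannot get the same woman w, one from X and one from Y: the
    -- rival of the latter would be the former, who does not prefer Y.
    crossed : ∀ {a a′ w b′ b} → X a ≡ just w → Y a ≡ just b′ → rankA a w ≤ rankA a b′ →
              X a′ ≡ just b → Y a′ ≡ just w → rankA a′ w < rankA a′ b → ⊥
    crossed xa ya w≽b′ xa′ ya′ w≻b with rival ssY ssX ya′ (inj₂ (_ , xa′ , w≻b))
    ... | a₃ , xa₃ , v , ya₃ , pref with partner-injective ssX xa₃ xa
    ... | refl with just-unique ya₃ ya
    ... | refl = <⇒≱ (prefA⇒< {X} pref xa) w≽b′

    ⊔-injective : ∀ {a a′ w} → W a ≡ just w → W a′ ≡ just w → a ≡ a′
    ⊔-injective wa wa′ with source wa | source wa′
    ... | from-X xa _ _   | from-X xa′ _ _   = partner-injective ssX xa xa′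
    ... | from-Y _ ya _   | from-Y _ ya′ _   = partner-injective ssY ya ya′
    ... | from-X xa ya le | from-Y xa′ ya′ lt = ⊥-elim (crossed xa ya le xa′ ya′ lt)
    ... | from-Y xa ya lt | from-X xa′ ya′ le = ⊥-elim (crossed xa′ ya′ le xa ya lt)

    W-free⇒X-free : ∀ {w} → (∀ a → W a ≢ just w) → ∀ a → X a ≢ just w
    W-free⇒X-free w-free a xa = let a′ , wa′ = ⊔-covers-X xa in w-free a′ wa′

    no-block-by-man : ∀ {a w} → Edge G a w → PrefA G W a w → WPrefB G W w a → ⊥
    no-block-by-man {a} {w} e pref (inj₁ w-free) = not-blocking ssX a w
      (e , prefA⇒≢ {X} pX , inj₁ (pX , inj₁ (W-free⇒X-free w-free)))
      where pX = proj₁ (⊔-pref pref)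
    no-block-by-man {a} {w} e pref (inj₂ (a₁ , wa₁ , a≽a₁)) with source wa₁
    ... | from-X xa₁ _ _ = not-blocking ssX a w
      (e , prefA⇒≢ {X} pX , inj₁ (pX , inj₂ (a₁ , xa₁ , a≽a₁)))
      where pX = proj₁ (⊔-pref pref)
    ... | from-Y _ ya₁ _ = not-blocking ssY a w
      (e , prefA⇒≢ {Y} pY , inj₁ (pY , inj₂ (a₁ , ya₁ , a≽a₁)))
      where pY = proj₂ (⊔-pref pref)

    no-block-by-woman : ∀ {a w} → Edge G a w → W a ≢ just w → PrefB G W w a →
                        WPrefA G W a w → ⊥
    no-block-by-woman {a} {w} e _ (inj₁ w-free) wpref = not-blocking ssX a w
      (e , W-free⇒X-free w-free a , inj₂ (inj₁ (W-free⇒X-free w-free) , proj₁ (⊔-wpref wpref)))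
    no-block-by-woman {a} {w} e wa≢w (inj₂ (a₁ , wa₁ , a≻a₁)) wpref with source wa₁
    ... | from-X xa₁ _ _ = not-blocking ssX a w
      (e , (λ xa → wa≢w (subst (λ x → W x ≡ just w) (partner-injective ssX xa₁ xa) wa₁)) ,
       inj₂ (inj₂ (a₁ , xa₁ , a≻a₁) , proj₁ (⊔-wpref wpref)))
    ... | from-Y _ ya₁ _ = not-blocking ssY a w
      (e , (λ ya → wa≢w (subst (λ x → W x ≡ just w) (partner-injective ssY ya₁ ya) wa₁)) ,
       inj₂ (inj₂ (a₁ , ya₁ , a≻a₁) , proj₂ (⊔-wpref wpref)))

    ⊔-edge : ∀ a w → W a ≡ just w → Edge G a w
    ⊔-edge a w wa with source wa
    ... | from-X xa _ _ = edge-of ssX xa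
    ... | from-Y _ ya _ = edge-of ssY ya

    ⊔-SS : SS W
    ⊔-SS = (⊔-edge , λ a a′ w → ⊔-injective) , λ where
      a w (e , _ , inj₁ (pref , wprefB)) → no-block-by-man e pref wprefB
      a w (e , wa≢w , inj₂ (prefB , wpref)) → no-block-by-woman e wa≢w prefB wpref

  open Join using (⊔-SS; ⊔-dominates-X; ⊔-dominates-Y)

  -- Maximality of M(a,b) extends to every strongly stable P in which a has a
  -- partner no better than b: N ⊔ P is strongly stable and still contains
  -- (a,b), so N ⪰ N ⊔ P ⪰ P.
  mab-dominates : ∀ {a b N P y} → IsMab G a b N → SS P → P a ≡ just y →
                  rankA a b ≤ rankA a y → N ⪰′ P
  mab-dominates {N = N} {P} (ssN , na , maximal) ssP pa b≽y =
    ⪰-trans ssN ssN⊔P (maximal (N ⊔ P) ssN⊔P (⊔-keeps {N} {P} na pa b≽y))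
                      (⊔-dominates-Y ssN ssP)
    where
    ssN⊔P : SS (N ⊔ P)
    ssN⊔P = ⊔-SS ssN ssP

  matchings : List (Matching G)
  matchings = functions (nothing ∷ map just (allFin n)) m

  matchings-complete : ∀ X → Any (_≗ X) matchings
  matchings-complete = functions-complete every m
    where
    every : ∀ u → u ∈ nothing ∷ map just (allFin n)
    every nothing  = here refl
    every (just w) = there (∈-map⁺ just (∈-allFin w))

  module _ (a : Fin m) (b : Fin n) where

    Contains : Matching G → Set
    Contains X = SS X × X a ≡ just b

    dominate-list : ∀ {N₀} → Contains N₀ → (gs : List (Matching G)) →
                    ∃[ N ] (Contains N × All (λ g → Contains g → N ⪰′ g) gs)
    dominate-list c₀ [] = _ , c₀ , []
    dominate-list c₀ (g ∷ gs) with dominate-list c₀ gs | SS? g ×-dec (g a ≟ₘ just b)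
    ... | N , (ssN , na) , dom | yes (ssg , ga) =
      N ⊔ g , (⊔-SS ssN ssg , ⊔-keeps {N} {g} na ga ≤-refl) ,
      (λ _ → ⊔-dominates-Y ssN ssg) ∷
      All.map (λ N⪰ cg → ⪰-trans (⊔-SS ssN ssg) ssN (⊔-dominates-X ssN ssg) (N⪰ cg)) dom
    ... | N , cN , dom | no ¬cg = N , cN , (λ cg → ⊥-elim (¬cg cg)) ∷ dom

  mab-exists : ∀ {M₀ a b} → SS M₀ → M₀ a ≡ just b → ∃[ N ] IsMab G a b N
  mab-exists {a = a} {b} ssM₀ m₀a with dominate-list a b (ssM₀ , m₀a) matchings
  ... | N , (ssN , na) , dom = N , ssN , na , maximal
    where
    maximal : ∀ N′ → SS N′ → N′ a ≡ just b → N ⪰′ N′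
    maximal N′ ssN′ n′a with lookupAny dom (matchings-complete N′)
    ... | N⪰g , g≗N′ = λ x c c′ nx n′x →
      N⪰g (SS-resp-≗ g≗N′ ssN′ , trans (g≗N′ a) n′a) x c c′ nx (trans (g≗N′ x) n′x)

  ∨-both : ∀ {K P a k x} → K a ≡ just k → P a ≡ just x →
           (K ∨′ P) a ≡ (if rankA a k <ᵇ rankA a x then just x else just k)
  ∨-both ka pa rewrite ka | pa = refl

  ∨-worse : ∀ {K P a k x} → K a ≡ just k → P a ≡ just x →
            ∃[ y ] ((K ∨′ P) a ≡ just y × (K a ≡ just y ⊎ P a ≡ just y) ×
                    rankA a k ≤ rankA a y × rankA a x ≤ rankA a y)
  ∨-worse {K} {P} {a} {k} {x} ka pa with if-<ᵇ (rankA a k) (rankA a x) (just x) (just k)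
  ... | inj₁ (k≻x , e) = x , trans (∨-both {K} {P} ka pa) e , inj₂ pa , <⇒≤ k≻x , ≤-refl
  ... | inj₂ (x≽k , e) = k , trans (∨-both {K} {P} ka pa) e , inj₁ ka , ≤-refl , x≽k

  Above : Fin m → Fin n → Matching G → Set
  Above a y P = ∀ {x} → P a ≡ just x → rankA a x ≤ rankA a y

  ⋁-worst : ∀ {a k} K ts → K a ≡ just k → All (λ P → ∃[ x ] P a ≡ just x) ts →
            ∃[ y ] (foldl _∨′_ K ts a ≡ just y × Any (λ P → P a ≡ just y) (K ∷ ts) ×
                    All (Above a y) (K ∷ ts))
  ⋁-worst K [] ka [] = _ , ka , here ka , (λ ka′ → ≤-reflexive (cong (rankA _) (just-unique ka′ ka))) ∷ []
  ⋁-worst {a} K (t ∷ ts) ka ((x , ta) ∷ matched)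
    with k′ , k′a , origin , k≤k′ , x≤k′ ← ∨-worse {K} {t} ka ta
    with y , ya , y∈ , above-join ∷ above ← ⋁-worst (K ∨′ t) ts k′a matched
    = y , ya , from-join y∈ , above-via {K} k≤k′ ka ∷ above-via {t} x≤k′ ta ∷ above
    where
    above-via : ∀ {P u} → rankA a u ≤ rankA a k′ → P a ≡ just u → Above a y P
    above-via u≤k′ pa pa′ rewrite just-unique pa′ pa = ≤-trans u≤k′ (above-join k′a)

    from-join : Any (λ P → P a ≡ just y) ((K ∨′ t) ∷ ts) → Any (λ P → P a ≡ just y) (K ∷ t ∷ ts)
    from-join (there y∈ts) = there (there y∈ts)
    from-join (here ya′) = Sum.[ here , (λ tay → there (here tay)) ]′
      (subst (λ u → K a ≡ just u ⊎ t a ≡ just u) (just-unique k′a ya′) origin)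

  module Worst (s : Matching G) (ss : List (Matching G)) (stable : All SS (s ∷ ss))
               {M : Matching G} (ssM : SS M) (M∼⋁ : M ∼′ ⋁ G s ss) where

    private
      ⋁-at : ∀ {a b} → M a ≡ just b →
             ∃[ y ] (⋁ G s ss a ≡ just y × Any (λ P → P a ≡ just y) (s ∷ ss) ×
                     All (Above a y) (s ∷ ss))
      ⋁-at ma with _ , sa ← same-men ssM (All.head stable) ma =
        ⋁-worst s ss sa (All.map (λ ssP → same-men ssM ssP ma) (All.tail stable))

    worse-than-S : ∀ {a b P x} → M a ≡ just b → P ∈ s ∷ ss → P a ≡ just x →
                   rankA a x ≤ rankA a b
    worse-than-S ma P∈S pa with y , ja , _ , above ← ⋁-at ma =
      ≤-trans (lookup above P∈S pa) (≤-reflexive (sym (M∼⋁ _ _ y ma ja)))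

    attained-in-S : ∀ {a b} → M a ≡ just b →
                    ∃[ P ] (P ∈ s ∷ ss × ∃[ y ] (P a ≡ just y × rankA a b ≡ rankA a y))
    attained-in-S ma with y , ja , y∈S , _ ← ⋁-at ma with P , P∈S , pa ← find y∈S =
      P , P∈S , y , pa , M∼⋁ _ _ y ma ja

lemma8 : (G : Instance) (s : Matching G) (ss : List (Matching G)) →
    All (Irreducible G) (s ∷ ss) →
    Closed G (s ∷ ss) →
    (M : Matching G) → StronglyStable G M →
    _∼_ G M (⋁ G s ss) →
    (T : Matching G) → StronglyStable G T →
    ((_∈ₛ_ G T (s ∷ ss) → InCU G M T) × (InCU G M T → _∈ₛ_ G T (s ∷ ss)))
lemma8 G s ss irreducible closed M ssM M∼⋁ T ssT = S⊆CU , CU⊆S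
  where
  open Instance G using (rankA)
  open Theory G
  open Worst s ss (All.map proj₁ irreducible) ssM M∼⋁

  -- [T] = [P] = M(c,d) with P ∈ S; with b = M(c), rank d ≤ rank b, so
  -- M(c,d) ⪰ M(c,b) and (c,b) ∈ M witnesses [T] ∈ C(U(M))
  S⊆CU : _∈ₛ_ G T (s ∷ ss) → InCU G M T
  S⊆CU T∈S with P , P∈S , T∼P ← find T∈S
    with ssP , c , d , N , mab@(ssN , nc , _) , P∼N ← lookup irreducible P∈S
    with b , mc ← same-men ssN ssM nc
    with x , pc ← same-men ssN ssP nc
    with Q , mabQ@(ssQ , qc , _) ← mab-exists ssM mc =
    (ssT , c , d , N , mab , T∼N) , c , b , Q , mc , mabQ ,
    ⪰-trans ssT ssN (∼⇒⪰ T∼N) (mab-dominates mab ssQ qc d≽b)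
    where
    T∼N : T ∼′ N
    T∼N = ∼-trans ssT ssP T∼P P∼N
    d≽b : rankA c d ≤ rankA c b
    d≽b = subst (_≤ rankA c b) (P∼N c x d pc nc) (worse-than-S mc P∈S pc)

  -- M(a) is tied with the partner of a in some P ∈ S, so M(a,b) ⪰ P and
  -- T ⪰ P; closedness of S gives [T] ∈ S
  CU⊆S : InCU G M T → _∈ₛ_ G T (s ∷ ss)
  CU⊆S (irreducibleT , a , b , N , ma , mab@(ssN , _ , _) , T⪰N)
    with P , P∈S , y , pa , b≈y ← attained-in-S ma =
    closed P T P∈S irreducibleT
      (⪰-trans ssT ssN T⪰N (mab-dominates mab (lookup (All.map proj₁ irreducible) P∈S) pa (≤-reflexive b≈y)))
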